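{- Let $\mathcal{G}$ be a hyper-environment. If there is an HCP term $P$ with $\vdash P:\mathcal{G}$ in HCP, then there is a CP term $Q$ and a channel name $z$ with $\vdash Q: z:\bigotimes\mathcal{G}$ in CP, where $\bigotimes\varnothing=\mathbf{1}$ and $\bigotimes(\Gamma_1\mid\dots\mid\Gamma_n)=⅋\Gamma_1\otimes\dots\otimes⅋\Gamma_n$ for $n\ge1$, with $⅋(\cdot)=\bot$ for the empty environment and $⅋(x_1:A_1,\dots,x_k:A_k)=A_1⅋\dots⅋A_k$ for $k\ge1$.
   Context: Session types: $A,B ::= A\otimes B \mid \mathbf{1} \mid A ⅋ B \mid \bot \mid A\oplus B \mid \mathbf{0} \mid A \& B \mid \top$, with duality the involution $(A\otimes B)^\bot = A^\bot ⅋ B^\bot$, $(A ⅋ B)^\bot = A^\bot\otimes B^\bot$, $\mathbf{1}^\bot=\bot$, $\bot^\bot=\mathbf{1}$, $(A\oplus B)^\bot = A^\bot \& B^\bot$, $(A\& B)^\bot = A^\bot\oplus B^\bot$, $\mathbf{0}^\bot=\top$, $\top^\bot=\mathbf{0}$. An environment is a finite list $x_1:A_1,\dots,x_n:A_n$ of pairwise distinct names with types; $\Gamma,\Delta$ requires disjoint names. A hyper-environment is a finite multiset $\Gamma_1\mid\dots\mid\Gamma_n$ of environments (empty: $\varnothing$); names may be shared between its environments. Iterated $\otimes$ and $⅋$ are read as associated to the right. CP terms: $P,Q ::= x\leftrightarrow y \mid \nu x(P\parallel Q)$ (cut; $x$ bound in $P$ and $Q$) $\mid x[y](P\parallel Q)$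 (output; $y$ bound in $P$, $x$ continues in $Q$) $\mid x(y).P$ ($y$ bound in $P$) $\mid x[].0 \mid x().P \mid x\triangleleft\mathrm{inl}.P\mid x\triangleleft\mathrm{inr}.P\mid x\triangleright\{\mathrm{inl}:P;\mathrm{inr}:Q\}\mid x\triangleright\{\}$. CP typing $\vdash P:\Gamma$: (Ax) $\vdash x\leftrightarrow y:x:A,y:A^\bot$; (Cut) from $\vdash P:\Gamma,x:A$ and $\vdash Q:\Delta,x:A^\bot$ infer $\vdash \nu x(P\parallel Q):\Gamma,\Delta$; ($\otimes$) from $\vdash P:\Gamma,y:A$ and $\vdash Q:\Delta,x:B$ infer $\vdash x[y](P\parallel Q):\Gamma,\Delta,x:A\otimes B$; ($⅋$) from $\vdash P:\Gamma,y:A,x:B$ infer $\vdash x(y).P:\Gamma,x:A⅋B$; ($\mathbf{1}$) $\vdash x[].0:x:\mathbf{1}$; ($\bot$) from $\vdash P:\Gamma$ infer $\vdash x().P:\Gamma,x:\bot$; ($\oplus_1$) from $\vdash P:\Gamma,x:A$ infer $\vdash x\triangleleft\mathrm{inl}.P:\Gamma,x:A\oplus B$; ($\oplus_2$) from $\vdash P:\Gamma,x:B$ infer $\vdash x\triangleleft\mathrm{inr}.P:\Gamma,x:A\oplus B$; ($\&$) from $\vdash P:\Gamma,x:A$ and $\vdash Q:\Gamma,x:B$ infer $\vdash x\triangleright\{\mathrm{inl}:P;\mathrm{inr}:Q\}:\Gamma,x:A\&B$; ($\top$) $\vdash x\triangleright\{\}:\Gamma,x:\top$; no rule for $\mathbf{0}$.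 HCP terms: $P,Q,R ::= x\leftrightarrow y \mid 0 \mid (\nu x)P$ (binds $x$) $\mid (P \mid Q) \mid x[y].P$ ($y$ bound in $P$) $\mid x(y).P$ ($y$ bound in $P$) $\mid x[].P \mid x().P \mid x\triangleleft \mathrm{inl}.P \mid x\triangleleft\mathrm{inr}.P \mid x\triangleright\{\mathrm{inl}:P;\mathrm{inr}:Q\} \mid x\triangleright\{\}$. HCP typing $\vdash P:\mathcal{G}$: (Ax) $\vdash x\leftrightarrow y : x:A, y:A^\bot$. (H-Cut) from $\vdash P:\mathcal{G}\mid \Gamma, x:A \mid \Delta, x:A^\bot$ infer $\vdash (\nu x)P : \mathcal{G}\mid \Gamma,\Delta$. (H-Mix) from $\vdash P:\mathcal{G}$, $\vdash Q:\mathcal{H}$ infer $\vdash (P\mid Q): \mathcal{G}\mid\mathcal{H}$. (H-Mix$_0$) $\vdash 0:\varnothing$. ($\otimes$) from $\vdash P : \mathcal{G}\mid \Gamma, y:A \mid \Delta, x:B$ infer $\vdash x[y].P : \mathcal{G}\mid\Gamma,\Delta,x:A\otimes B$. ($⅋$) from $\vdash P : \mathcal{G}\mid\Gamma, y:A, x:B$ infer $\vdash x(y).P : \mathcal{G}\mid\Gamma, x:A⅋B$. ($\mathbf{1}$) from $\vdash P:\mathcal{G}$ infer $\vdash x[].P : \mathcal{G}\mid x:\mathbf{1}$. ($\bot$) from $\vdash P:\mathcal{G}\mid\Gamma$ infer $\vdash x().P : \mathcal{G}\mid\Gamma,x:\bot$. ($\oplus_1$) from $\vdash P:\mathcal{G}\mid\Gamma,x:A$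 infer $\vdash x\triangleleft\mathrm{inl}.P:\mathcal{G}\mid\Gamma,x:A\oplus B$; ($\oplus_2$) analogously with $\mathrm{inr}$ and $x:B$. ($\&$) from $\vdash P:\Gamma,x:A$ and $\vdash Q:\Gamma,x:B$ infer $\vdash x\triangleright\{\mathrm{inl}:P;\mathrm{inr}:Q\}:\Gamma,x:A\&B$. ($\top$) $\vdash x\triangleright\{\}:\Gamma,x:\top$. No rule for $\mathbf{0}$. Each logical rule ($\otimes,⅋,\mathbf{1},\bot,\oplus_1,\oplus_2$) has the side condition that $x$ does not occur in $\mathcal{G}$. -}

module Defs where

open import Data.Nat using (ℕ)
open import Data.Product using (_×_; _,_; proj₁)
open import Data.List using (List; []; _∷_; _++_; [_]; map)
open import Data.List.Relation.Unary.All using (All)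
open import Data.List.Relation.Unary.Unique.Propositional using (Unique)
open import Data.List.Membership.Propositional using (_∉_)
open import Data.List.Relation.Binary.Permutation.Propositional using (_↭_)
open import Relation.Binary.PropositionalEquality using (_≢_)

Name : Set
Name = ℕ

data Ty : Set where
  _⊗_ : Ty → Ty → Ty
  𝟏   : Ty
  _⅋_ : Ty → Ty → Ty
  ⊥̂   : Ty
  _⊕_ : Ty → Ty → Ty
  𝟎   : Ty
  _&_ : Ty → Ty → Ty
  ⊤̂   : Ty

infixr 6 _⊗_ _⅋_
infixr 5 _⊕_ _&_

dual : Ty → Ty
dual (A ⊗ B) = dual A ⅋ dual B
dual 𝟏 = ⊥̂
dual (A ⅋ B) = dual A ⊗ dual B
dual ⊥̂ = 𝟏
dual (A ⊕ B) = dual A & dual B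
dual 𝟎 = ⊤̂
dual (A & B) = dual A ⊕ dual B
dual ⊤̂ = 𝟎

-- Environments: lists of name/type pairs, read up to exchange (see typing rules)
Env : Set
Env = List (Name × Ty)

names : Env → List Name
names Γ = map proj₁ Γ

Distinct : Env → Set
Distinct Γ = Unique (names Γ)

-- Hyper-environments: finite multisets of environments, represented as lists
-- read up to permutation (exchange rule below). G ∣ Γ is written Γ ∷ G.
HEnv : Set
HEnv = List Env

HWf : HEnv → Set
HWf 𝒢 = All Distinct 𝒢

NotIn : Name → HEnv → Set
NotIn x 𝒢 = All (λ Γ → x ∉ names Γ) 𝒢

data CP : Set where
  link   : Name → Name → CP
  cut    : Name → CP → CP → CP            -- ν x (P ∥ Q)
  out    : Name → Name → CP → CP → CP     -- x[y](P ∥ Q)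
  inp    : Name → Name → CP → CP          -- x(y).P
  close  : Name → CP
  wait   : Name → CP → CP
  inl    : Name → CP → CP
  inr    : Name → CP → CP
  case   : Name → CP → CP → CP
  absurd : Name → CP

data ⊢CP_∶_ : CP → Env → Set where
  ax   : ∀ {x y A} → x ≢ y → ⊢CP link x y ∶ ((x , A) ∷ (y , dual A) ∷ [])
  cutR : ∀ {P Q Γ Δ x A} → Distinct (Γ ++ Δ) →
         ⊢CP P ∶ (Γ ++ [ (x , A) ]) → ⊢CP Q ∶ (Δ ++ [ (x , dual A) ]) →
         ⊢CP cut x P Q ∶ (Γ ++ Δ)
  ⊗R   : ∀ {P Q Γ Δ x y A B} → Distinct (Γ ++ Δ ++ [ (x , A ⊗ B) ]) →
         ⊢CP P ∶ (Γ ++ [ (y , A) ]) → ⊢CP Q ∶ (Δ ++ [ (x , B) ]) →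
         ⊢CP out x y P Q ∶ (Γ ++ Δ ++ [ (x , A ⊗ B) ])
  ⅋R   : ∀ {P Γ x y A B} → Distinct (Γ ++ [ (x , A ⅋ B) ]) →
         ⊢CP P ∶ (Γ ++ (y , A) ∷ (x , B) ∷ []) →
         ⊢CP inp x y P ∶ (Γ ++ [ (x , A ⅋ B) ])
  𝟏R   : ∀ {x} → ⊢CP close x ∶ [ (x , 𝟏) ]
  ⊥R   : ∀ {P Γ x} → Distinct (Γ ++ [ (x , ⊥̂) ]) →
         ⊢CP P ∶ Γ → ⊢CP wait x P ∶ (Γ ++ [ (x , ⊥̂) ])
  ⊕₁R  : ∀ {P Γ x A B} → Distinct (Γ ++ [ (x , A ⊕ B) ]) →
         ⊢CP P ∶ (Γ ++ [ (x , A) ]) → ⊢CP inl x P ∶ (Γ ++ [ (x , A ⊕ B) ])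
  ⊕₂R  : ∀ {P Γ x A B} → Distinct (Γ ++ [ (x , A ⊕ B) ]) →
         ⊢CP P ∶ (Γ ++ [ (x , B) ]) → ⊢CP inr x P ∶ (Γ ++ [ (x , A ⊕ B) ])
  &R   : ∀ {P Q Γ x A B} → Distinct (Γ ++ [ (x , A & B) ]) →
         ⊢CP P ∶ (Γ ++ [ (x , A) ]) → ⊢CP Q ∶ (Γ ++ [ (x , B) ]) →
         ⊢CP case x P Q ∶ (Γ ++ [ (x , A & B) ])
  ⊤R   : ∀ {Γ x} → Distinct (Γ ++ [ (x , ⊤̂) ]) →
         ⊢CP absurd x ∶ (Γ ++ [ (x , ⊤̂) ])
  ex   : ∀ {P Γ Γ'} → Γ ↭ Γ' → ⊢CP P ∶ Γ → ⊢CP P ∶ Γ'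

data HCP : Set where
  link   : Name → Name → HCP
  nil    : HCP
  new    : Name → HCP → HCP
  par    : HCP → HCP → HCP
  out    : Name → Name → HCP → HCP       -- x[y].P
  inp    : Name → Name → HCP → HCP       -- x(y).P
  close  : Name → HCP → HCP
  wait   : Name → HCP → HCP
  inl    : Name → HCP → HCP
  inr    : Name → HCP → HCP
  case   : Name → HCP → HCP → HCP
  absurd : Name → HCP

data ⊢H_∶_ : HCP → HEnv → Set where
  ax   : ∀ {x y A} → x ≢ y → ⊢H link x y ∶ [ (x , A) ∷ (y , dual A) ∷ [] ]
  cutR : ∀ {P 𝒢 Γ Δ x A} → HWf ((Γ ++ Δ) ∷ 𝒢) →
         ⊢H P ∶ ((Γ ++ [ (x , A) ]) ∷ (Δ ++ [ (x , dual A) ]) ∷ 𝒢) →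
         ⊢H new x P ∶ ((Γ ++ Δ) ∷ 𝒢)
  mix  : ∀ {P Q 𝒢 ℋ} → ⊢H P ∶ 𝒢 → ⊢H Q ∶ ℋ → ⊢H par P Q ∶ (𝒢 ++ ℋ)
  mix₀ : ⊢H nil ∶ []
  ⊗R   : ∀ {P 𝒢 Γ Δ x y A B} → NotIn x 𝒢 →
         HWf ((Γ ++ Δ ++ [ (x , A ⊗ B) ]) ∷ 𝒢) →
         ⊢H P ∶ ((Γ ++ [ (y , A) ]) ∷ (Δ ++ [ (x , B) ]) ∷ 𝒢) →
         ⊢H out x y P ∶ ((Γ ++ Δ ++ [ (x , A ⊗ B) ]) ∷ 𝒢)
  ⅋R   : ∀ {P 𝒢 Γ x y A B} → NotIn x 𝒢 →
         HWf ((Γ ++ [ (x , A ⅋ B) ]) ∷ 𝒢) →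
         ⊢H P ∶ ((Γ ++ (y , A) ∷ (x , B) ∷ []) ∷ 𝒢) →
         ⊢H inp x y P ∶ ((Γ ++ [ (x , A ⅋ B) ]) ∷ 𝒢)
  𝟏R   : ∀ {P 𝒢 x} → NotIn x 𝒢 →
         ⊢H P ∶ 𝒢 → ⊢H close x P ∶ ([ (x , 𝟏) ] ∷ 𝒢)
  ⊥R   : ∀ {P 𝒢 Γ x} → NotIn x 𝒢 → HWf ((Γ ++ [ (x , ⊥̂) ]) ∷ 𝒢) →
         ⊢H P ∶ (Γ ∷ 𝒢) → ⊢H wait x P ∶ ((Γ ++ [ (x , ⊥̂) ]) ∷ 𝒢)
  ⊕₁R  : ∀ {P 𝒢 Γ x A B} → NotIn x 𝒢 → HWf ((Γ ++ [ (x , A ⊕ B) ]) ∷ 𝒢) →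
         ⊢H P ∶ ((Γ ++ [ (x , A) ]) ∷ 𝒢) →
         ⊢H inl x P ∶ ((Γ ++ [ (x , A ⊕ B) ]) ∷ 𝒢)
  ⊕₂R  : ∀ {P 𝒢 Γ x A B} → NotIn x 𝒢 → HWf ((Γ ++ [ (x , A ⊕ B) ]) ∷ 𝒢) →
         ⊢H P ∶ ((Γ ++ [ (x , B) ]) ∷ 𝒢) →
         ⊢H inr x P ∶ ((Γ ++ [ (x , A ⊕ B) ]) ∷ 𝒢)
  &R   : ∀ {P Q Γ x A B} → Distinct (Γ ++ [ (x , A & B) ]) →
         ⊢H P ∶ [ Γ ++ [ (x , A) ] ] → ⊢H Q ∶ [ Γ ++ [ (x , B) ] ] →
         ⊢H case x P Q ∶ [ Γ ++ [ (x , A & B) ] ]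
  ⊤R   : ∀ {Γ x} → Distinct (Γ ++ [ (x , ⊤̂) ]) →
         ⊢H absurd x ∶ [ Γ ++ [ (x , ⊤̂) ] ]
  ex   : ∀ {P 𝒢 Γ Γ'} → Γ ↭ Γ' → ⊢H P ∶ (Γ ∷ 𝒢) → ⊢H P ∶ (Γ' ∷ 𝒢)
  hex  : ∀ {P 𝒢 𝒢'} → 𝒢 ↭ 𝒢' → ⊢H P ∶ 𝒢 → ⊢H P ∶ 𝒢'

⅋Env : Env → Ty
⅋Env [] = ⊥̂
⅋Env ((x , A) ∷ []) = A
⅋Env ((x , A) ∷ Γ@(_ ∷ _)) = A ⅋ ⅋Env Γ

⊗H : HEnv → Ty
⊗H [] = 𝟏
⊗H (Γ ∷ []) = ⅋Env Γ
⊗H (Γ ∷ 𝒢@(_ ∷ _)) = ⅋Env Γ ⊗ ⊗H 𝒢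

module Submission where

-- The proof passes through ⊢ₛ, a name-free one-sided sequent calculus for
-- CP (sequents are lists of types, with cut and exchange, without mix).
--
--  * Naming.  A ⊢ₛ-derivation of Γ can be decorated with channel names:
--    for every environment E with pairwise distinct names whose types are
--    Γ we obtain a CP term typed by E; premises of cut, ⊗ and ⅋ get fresh
--    names.  This is where the bookkeeping of names is confined.
--  * Collapse.  Every HCP derivation of 𝒢 gives a ⊢ₛ-derivation of ⊗𝒢.
--    Writing ⅋Γ⊥ for dual (⅋Env Γ), the sequent ⅋Γ⊥, Γ is derivable
--    (identity expansion), and ⊗𝒢 can be cut against a derivation of
--    ⅋Γ₁⊥, …, ⅋Γₙ⊥, Δ.  An HCP rule acting on the components ℋ of a
--    hyper-environment is therefore simulated by applying the corresponding
--    CP rule to the identity expansions of the components in ℋ and cutting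
--    the result against the interpretation of the premise.
--
-- The theorem names the collapsed derivation with a single channel.

open import Defs
open import Data.Nat using (ℕ; suc)
open import Data.Nat.Properties using (1+n≰n)
open import Data.Product using (Σ; _,_; _×_; proj₁; proj₂)
open import Data.List using (List; []; _∷_; _++_; [_]; map)
open import Data.List.Properties using (map-++; ++-assoc; ++-identityʳ; ∷-injectiveˡ; ∷-injectiveʳ)
open import Data.List.Extrema.Nat using (max; xs≤max)
open import Data.List.Relation.Unary.All using (lookup; []; _∷_)
import Data.List.Relation.Unary.All.Properties as All
open import Data.List.Relation.Unary.Any using (here)
open import Data.List.Relation.Unary.AllPairs using ([]; _∷_)
open import Data.List.Relation.Unary.Unique.Propositional using (Unique)
import Data.List.Relation.Unary.Unique.Propositional.Properties as Unique
open import Data.List.Membership.Propositional using (_∉_)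
open import Data.List.Membership.Propositional.Properties using (∈-++⁺ˡ; ∈-++⁺ʳ)
open import Data.List.Relation.Binary.Permutation.Propositional
open import Data.List.Relation.Binary.Permutation.Propositional.Properties
  using (map⁺; ↭-map-inv; shift; ++-comm; ∷↭∷ʳ; ++⁺ˡ; ++⁺ʳ)
open import Relation.Binary.PropositionalEquality
  using (_≡_; refl; sym; cong; cong₂; subst; setoid) renaming (trans to ≡-trans)
open import Data.List.Relation.Binary.Permutation.Setoid.Properties (setoid ℕ)
  using (Unique-resp-↭)

-- The name-free calculus: CP typing with the channel names erased.
data ⊢ₛ_ : List Ty → Set where
  sax : ∀ {A} → ⊢ₛ (A ∷ dual A ∷ [])
  scut : ∀ {Γ Δ A} → ⊢ₛ (Γ ++ [ A ]) → ⊢ₛ (Δ ++ [ dual A ]) → ⊢ₛ (Γ ++ Δ)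
  s⊗ : ∀ {Γ Δ A B} → ⊢ₛ (Γ ++ [ A ]) → ⊢ₛ (Δ ++ [ B ]) → ⊢ₛ (Γ ++ Δ ++ [ A ⊗ B ])
  s⅋ : ∀ {Γ A B} → ⊢ₛ (Γ ++ A ∷ B ∷ []) → ⊢ₛ (Γ ++ [ A ⅋ B ])
  s𝟏 : ⊢ₛ [ 𝟏 ]
  s⊥ : ∀ {Γ} → ⊢ₛ Γ → ⊢ₛ (Γ ++ [ ⊥̂ ])
  s⊕₁ : ∀ {Γ A B} → ⊢ₛ (Γ ++ [ A ]) → ⊢ₛ (Γ ++ [ A ⊕ B ])
  s⊕₂ : ∀ {Γ A B} → ⊢ₛ (Γ ++ [ B ]) → ⊢ₛ (Γ ++ [ A ⊕ B ])
  s& : ∀ {Γ A B} → ⊢ₛ (Γ ++ [ A ]) → ⊢ₛ (Γ ++ [ B ]) → ⊢ₛ (Γ ++ [ A & B ])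
  s⊤ : ∀ {Γ} → ⊢ₛ (Γ ++ [ ⊤̂ ])
  sex : ∀ {Γ Γ'} → Γ ↭ Γ' → ⊢ₛ Γ → ⊢ₛ Γ'

tys : Env → List Ty
tys = map proj₂

tys-++ : ∀ E F → tys (E ++ F) ≡ tys E ++ tys F
tys-++ = map-++ proj₂

tys-extend : ∀ {E Γ} → tys E ≡ Γ → ∀ F → tys (E ++ F) ≡ Γ ++ tys F
tys-extend {E} p F = ≡-trans (tys-++ E F) (cong (_++ tys F) p)

names-++ : ∀ E F → names (E ++ F) ≡ names E ++ names F
names-++ = map-++ proj₁

names-retype : ∀ E {x A B} → names (E ++ [ (x , A) ]) ≡ names (E ++ [ (x , B) ])
names-retype E = ≡-trans (names-++ E _) (sym (names-++ E _))

Unique-++⁻ˡ : ∀ {A : Set} (xs : List A) {ys} → Unique (xs ++ ys) → Unique xs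
Unique-++⁻ˡ [] u = []
Unique-++⁻ˡ (x ∷ xs) (x∉ ∷ u) = All.++⁻ˡ xs x∉ ∷ Unique-++⁻ˡ xs u

Unique-++⁻ʳ : ∀ {A : Set} (xs : List A) {ys} → Unique (xs ++ ys) → Unique ys
Unique-++⁻ʳ [] u = u
Unique-++⁻ʳ (x ∷ xs) (_ ∷ u) = Unique-++⁻ʳ xs u

distinct-++ˡ : ∀ E {F} → Distinct (E ++ F) → Distinct E
distinct-++ˡ E {F} d = Unique-++⁻ˡ (names E) (subst Unique (names-++ E F) d)

distinct-++ʳ : ∀ E {F} → Distinct (E ++ F) → Distinct F
distinct-++ʳ E {F} d = Unique-++⁻ʳ (names E) (subst Unique (names-++ E F) d)

distinct-↭ : ∀ {E F} → E ↭ F → Distinct E → Distinct F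
distinct-↭ p = Unique-resp-↭ (↭⇒↭ₛ (map⁺ proj₁ p))

distinct-retype : ∀ E {x A B} → Distinct (E ++ [ (x , A) ]) → Distinct (E ++ [ (x , B) ])
distinct-retype E = subst Unique (names-retype E)

distinct-snoc : ∀ E {x A} → Distinct E → x ∉ names E → Distinct (E ++ [ (x , A) ])
distinct-snoc E {x} d x∉E = subst Unique (sym (names-++ E _))
  (Unique.++⁺ d ([] ∷ []) λ { (x∈E , here refl) → x∉E x∈E })

-- The premise environment of the ⅋ rule: the last channel x is split into
-- a fresh channel y and x itself.
distinct-⅋ : ∀ E {x y A B C} → Distinct (E ++ [ (x , C) ]) → y ∉ names (E ++ [ (x , C) ]) →
             Distinct (E ++ (y , A) ∷ (x , B) ∷ [])
distinct-⅋ E {x} {y} {A} {B} d y∉ = distinct-↭ reorder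
  (distinct-snoc (E ++ [ _ ]) (distinct-retype E d) (subst (_ ∉_) (names-retype E) y∉))
  where
  reorder : (E ++ [ (x , B) ]) ++ [ (y , A) ] ↭ E ++ (y , A) ∷ (x , B) ∷ []
  reorder = ↭-trans (↭-reflexive (++-assoc E _ _)) (++⁺ˡ E (swap _ _ refl))

∉-++⁻ : ∀ E F {x} → x ∉ names (E ++ F) → x ∉ names E × x ∉ names F
∉-++⁻ E F {x} x∉ = (λ p → x∉' (∈-++⁺ˡ p)) , (λ p → x∉' (∈-++⁺ʳ (names E) p))
  where
  x∉' : x ∉ names E ++ names F
  x∉' = subst (_ ∉_) (names-++ E F) x∉

fresh : Env → Name
fresh E = suc (max 0 (names E))

fresh-∉ : ∀ E → fresh E ∉ names E
fresh-∉ E p = 1+n≰n (lookup (xs≤max 0 (names E)) p)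

data Split (Γ Δ : List Ty) : Env → Set where
  split : ∀ E F → tys E ≡ Γ → tys F ≡ Δ → Split Γ Δ (E ++ F)

splitEnv : ∀ Γ {Δ} E → tys E ≡ Γ ++ Δ → Split Γ Δ E
splitEnv [] E eq = split [] E refl eq
splitEnv (A ∷ Γ) [] ()
splitEnv (A ∷ Γ) ((x , B) ∷ E) eq with splitEnv Γ E (∷-injectiveʳ eq)
... | split E₁ E₂ p₁ p₂ = split ((x , B) ∷ E₁) E₂ (cong₂ _∷_ (∷-injectiveˡ eq) p₁) p₂

data Snoc (Γ : List Ty) (A : Ty) : Env → Set where
  snoc : ∀ E x → tys E ≡ Γ → Snoc Γ A (E ++ [ (x , A) ])

splitLast : ∀ Γ {A} E → tys E ≡ Γ ++ [ A ] → Snoc Γ A E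
splitLast Γ E eq with splitEnv Γ E eq
... | split E₁ ((x , _) ∷ []) p refl = snoc E₁ x p
... | split E₁ [] p ()
... | split E₁ (_ ∷ _ ∷ _) p ()

Named : Env → Set
Named E = Σ CP λ Q → ⊢CP Q ∶ E

-- Each rule splits E along
-- its conclusion; channels introduced by the premises get fresh names.
name : ∀ {Γ} → ⊢ₛ Γ → (E : Env) → tys E ≡ Γ → Distinct E → Named E
name sax ((a , _) ∷ (b , _) ∷ []) refl ((a≢b ∷ []) ∷ _) = link a b , ax a≢b
name sax [] () _
name sax (_ ∷ []) () _
name sax (_ ∷ _ ∷ _ ∷ _) () _
name s𝟏 ((x , _) ∷ []) refl _ = close x , 𝟏R
name s𝟏 [] () _
name s𝟏 (_ ∷ _ ∷ _) () _
name (scut {Γ} {A = A} d e) E eq dis with splitEnv Γ E eq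
... | split E₁ E₂ p₁ p₂ =
  let x = fresh (E₁ ++ E₂)
      (x∉E₁ , x∉E₂) = ∉-++⁻ E₁ E₂ (fresh-∉ (E₁ ++ E₂))
      (P , ⊢P) = name d (E₁ ++ [ (x , A) ]) (tys-extend p₁ _)
                   (distinct-snoc E₁ (distinct-++ˡ E₁ dis) x∉E₁)
      (Q , ⊢Q) = name e (E₂ ++ [ (x , dual A) ]) (tys-extend p₂ _)
                   (distinct-snoc E₂ (distinct-++ʳ E₁ dis) x∉E₂)
  in cut x P Q , cutR dis ⊢P ⊢Q
name (s⊗ {Γ} {Δ} {A} {B} d e) E eq dis with splitEnv Γ E eq
... | split E₁ F p₁ q with splitLast Δ F q
... | snoc E₂ x p₂ =
  let y = fresh (E₁ ++ E₂ ++ [ (x , A ⊗ B) ])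
      (P , ⊢P) = name d (E₁ ++ [ (y , A) ]) (tys-extend p₁ _)
                   (distinct-snoc E₁ (distinct-++ˡ E₁ dis) (proj₁ (∉-++⁻ E₁ _ (fresh-∉ _))))
      (Q , ⊢Q) = name e (E₂ ++ [ (x , B) ]) (tys-extend p₂ _)
                   (distinct-retype E₂ (distinct-++ʳ E₁ dis))
  in out x y P Q , ⊗R dis ⊢P ⊢Q
name (s⅋ {Γ} d) E eq dis with splitLast Γ E eq
... | snoc E₁ x p =
  let y = fresh (E₁ ++ [ (x , _) ])
      (P , ⊢P) = name d (E₁ ++ (y , _) ∷ (x , _) ∷ []) (tys-extend p _)
                   (distinct-⅋ E₁ dis (fresh-∉ _))
  in inp x y P , ⅋R dis ⊢P
name (s⊥ {Γ} d) E eq dis with splitLast Γ E eq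
... | snoc E₁ x p =
  let (P , ⊢P) = name d E₁ p (distinct-++ˡ E₁ dis)
  in wait x P , ⊥R dis ⊢P
name (s⊕₁ {Γ} d) E eq dis with splitLast Γ E eq
... | snoc E₁ x p =
  let (P , ⊢P) = name d (E₁ ++ [ (x , _) ]) (tys-extend p _) (distinct-retype E₁ dis)
  in inl x P , ⊕₁R dis ⊢P
name (s⊕₂ {Γ} d) E eq dis with splitLast Γ E eq
... | snoc E₁ x p =
  let (P , ⊢P) = name d (E₁ ++ [ (x , _) ]) (tys-extend p _) (distinct-retype E₁ dis)
  in inr x P , ⊕₂R dis ⊢P
name (s& {Γ} d e) E eq dis with splitLast Γ E eq
... | snoc E₁ x p =
  let (P , ⊢P) = name d (E₁ ++ [ (x , _) ]) (tys-extend p _) (distinct-retype E₁ dis)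
      (Q , ⊢Q) = name e (E₁ ++ [ (x , _) ]) (tys-extend p _) (distinct-retype E₁ dis)
  in case x P Q , &R dis ⊢P ⊢Q
name (s⊤ {Γ}) E eq dis with splitLast Γ E eq
... | snoc E₁ x p = absurd x , ⊤R dis
-- Permute the environment backwards along the exchange.
name (sex p d) E refl dis with ↭-map-inv proj₂ (↭-sym p)
... | E₀ , tysE₀ , E↭E₀ =
  let (Q , ⊢Q) = name d E₀ (sym tysE₀) (distinct-↭ E↭E₀ dis)
  in Q , ex (↭-sym E↭E₀) ⊢Q

-- Duality is an involution; needed to read ⊗𝒢 as the dual of its consumer.
dual-involutive : ∀ A → dual (dual A) ≡ A
dual-involutive (A ⊗ B) = cong₂ _⊗_ (dual-involutive A) (dual-involutive B)
dual-involutive 𝟏 = refl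
dual-involutive (A ⅋ B) = cong₂ _⅋_ (dual-involutive A) (dual-involutive B)
dual-involutive ⊥̂ = refl
dual-involutive (A ⊕ B) = cong₂ _⊕_ (dual-involutive A) (dual-involutive B)
dual-involutive 𝟎 = refl
dual-involutive (A & B) = cong₂ _&_ (dual-involutive A) (dual-involutive B)
dual-involutive ⊤̂ = refl

⅋⋯ : List Ty → Ty
⅋⋯ [] = ⊥̂
⅋⋯ (A ∷ []) = A
⅋⋯ (A ∷ Ξ@(_ ∷ _)) = A ⅋ ⅋⋯ Ξ

⅋-intro : ∀ Θ Ξ → ⊢ₛ (Θ ++ Ξ) → ⊢ₛ (Θ ++ [ ⅋⋯ Ξ ])
⅋-intro Θ [] d = s⊥ (subst ⊢ₛ_ (++-identityʳ Θ) d)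
⅋-intro Θ (A ∷ []) d = d
⅋-intro Θ (A ∷ Ξ@(_ ∷ _)) d =
  s⅋ {Θ} (subst ⊢ₛ_ (++-assoc Θ [ A ] _)
    (⅋-intro (Θ ++ [ A ]) Ξ (subst ⊢ₛ_ (sym (++-assoc Θ [ A ] Ξ)) d)))

⅋-expand : ∀ Ξ → ⊢ₛ (dual (⅋⋯ Ξ) ∷ Ξ)
⅋-expand [] = s𝟏
⅋-expand (A ∷ []) = sex (swap _ _ refl) sax
⅋-expand (A ∷ Ξ@(_ ∷ _)) =
  sex (↭-sym (∷↭∷ʳ _ _)) (s⊗ {[ A ]} {Ξ} sax (sex (∷↭∷ʳ _ _) (⅋-expand Ξ)))

-- ⅋Γ⊥: the type by which an environment is consumed.
dual⅋ : Env → Ty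
dual⅋ Γ = dual (⅋Env Γ)

⅋Env≡⅋⋯ : ∀ Γ → ⅋Env Γ ≡ ⅋⋯ (tys Γ)
⅋Env≡⅋⋯ [] = refl
⅋Env≡⅋⋯ (_ ∷ []) = refl
⅋Env≡⅋⋯ ((_ , A) ∷ Γ@(_ ∷ _)) = cong (A ⅋_) (⅋Env≡⅋⋯ Γ)

dual-⊗H : ∀ 𝒢 → dual (⊗H 𝒢) ≡ ⅋⋯ (map dual⅋ 𝒢)
dual-⊗H [] = refl
dual-⊗H (_ ∷ []) = refl
dual-⊗H (Γ ∷ 𝒢@(_ ∷ _)) = cong (dual⅋ Γ ⅋_) (dual-⊗H 𝒢)

⅋Env-intro : ∀ Θ Γ Φ → ⊢ₛ (Θ ++ tys Γ ++ tys Φ) → ⊢ₛ (Θ ++ [ ⅋Env (Γ ++ Φ) ])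
⅋Env-intro Θ Γ Φ d =
  subst (λ B → ⊢ₛ (Θ ++ [ B ])) (sym (⅋Env≡⅋⋯ (Γ ++ Φ)))
    (⅋-intro Θ (tys (Γ ++ Φ)) (subst (λ Ξ → ⊢ₛ (Θ ++ Ξ)) (sym (tys-++ Γ Φ)) d))

env-expand : ∀ Γ → ⊢ₛ (dual⅋ Γ ∷ tys Γ)
env-expand Γ = subst (λ B → ⊢ₛ (dual B ∷ tys Γ)) (sym (⅋Env≡⅋⋯ Γ)) (⅋-expand (tys Γ))

focus : ∀ Γ Φ → ⊢ₛ (dual⅋ (Γ ++ Φ) ∷ tys Γ ++ tys Φ)
focus Γ Φ = subst (λ Ξ → ⊢ₛ (dual⅋ (Γ ++ Φ) ∷ Ξ)) (tys-++ Γ Φ) (env-expand (Γ ++ Φ))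

⊗H-expand : ∀ 𝒢 → ⊢ₛ (map dual⅋ 𝒢 ++ [ ⊗H 𝒢 ])
⊗H-expand 𝒢 = sex (∷↭∷ʳ _ _) (subst (λ B → ⊢ₛ (B ∷ map dual⅋ 𝒢)) dual-dual (⅋-expand (map dual⅋ 𝒢)))
  where
  dual-dual : dual (⅋⋯ (map dual⅋ 𝒢)) ≡ ⊗H 𝒢
  dual-dual = ≡-trans (cong dual (sym (dual-⊗H 𝒢))) (dual-involutive (⊗H 𝒢))

⊗H-cons : ∀ Θ Γ 𝒢 → ⊢ₛ (Θ ++ [ ⅋Env Γ ]) → ⊢ₛ (Θ ++ map dual⅋ 𝒢 ++ [ ⊗H (Γ ∷ 𝒢) ])
⊗H-cons Θ Γ [] d = d
⊗H-cons Θ Γ 𝒢@(_ ∷ _) d = s⊗ {Θ} {map dual⅋ 𝒢} d (⊗H-expand 𝒢)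

cut-components : ∀ Δ 𝒢 → ⊢ₛ [ ⊗H 𝒢 ] → ⊢ₛ (map dual⅋ 𝒢 ++ Δ) → ⊢ₛ Δ
cut-components Δ 𝒢 h d =
  scut {[]} {Δ} h (subst (λ B → ⊢ₛ (Δ ++ [ B ])) (sym (dual-⊗H 𝒢))
    (⅋-intro Δ (map dual⅋ 𝒢) (sex (++-comm (map dual⅋ 𝒢) Δ) d)))

-- Simulating an HCP rule: if the components ℋ of the premise entail the
-- environment Γ ++ Φ, then ℋ may be replaced by Γ ++ Φ in the hyper-environment.
lift : ∀ ℋ Γ Φ 𝒢 → ⊢ₛ (map dual⅋ ℋ ++ tys Γ ++ tys Φ) →
       ⊢ₛ [ ⊗H (ℋ ++ 𝒢) ] → ⊢ₛ [ ⊗H ((Γ ++ Φ) ∷ 𝒢) ]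
lift ℋ Γ Φ 𝒢 d h =
  cut-components _ (ℋ ++ 𝒢) h (subst ⊢ₛ_ regroup
    (⊗H-cons (map dual⅋ ℋ) (Γ ++ Φ) 𝒢 (⅋Env-intro (map dual⅋ ℋ) Γ Φ d)))
  where
  regroup : map dual⅋ ℋ ++ map dual⅋ 𝒢 ++ [ ⊗H ((Γ ++ Φ) ∷ 𝒢) ] ≡
            map dual⅋ (ℋ ++ 𝒢) ++ [ ⊗H ((Γ ++ Φ) ∷ 𝒢) ]
  regroup = ≡-trans (sym (++-assoc (map dual⅋ ℋ) _ _)) (cong (_++ _) (sym (map-++ dual⅋ ℋ 𝒢)))

⊗H-↭ : ∀ {𝒢 𝒢'} → 𝒢 ↭ 𝒢' → ⊢ₛ [ ⊗H 𝒢 ] → ⊢ₛ [ ⊗H 𝒢' ]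
⊗H-↭ {𝒢} {𝒢'} p h = cut-components _ 𝒢 h (sex (++⁺ʳ _ (map⁺ dual⅋ (↭-sym p))) (⊗H-expand 𝒢'))

⊗H-++ : ∀ 𝒢 ℋ → ⊢ₛ [ ⊗H 𝒢 ] → ⊢ₛ [ ⊗H ℋ ] → ⊢ₛ [ ⊗H (𝒢 ++ ℋ) ]
⊗H-++ 𝒢 ℋ g h =
  cut-components _ 𝒢 g (cut-components _ ℋ h (sex reorder (⊗H-expand (𝒢 ++ ℋ))))
  where
  reorder : map dual⅋ (𝒢 ++ ℋ) ++ [ ⊗H (𝒢 ++ ℋ) ] ↭ map dual⅋ ℋ ++ map dual⅋ 𝒢 ++ [ ⊗H (𝒢 ++ ℋ) ]
  reorder = ↭-trans (↭-reflexive (cong (_++ [ ⊗H (𝒢 ++ ℋ) ]) (map-++ dual⅋ 𝒢 ℋ)))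
    (↭-trans (++⁺ʳ [ ⊗H (𝒢 ++ ℋ) ] (++-comm (map dual⅋ 𝒢) (map dual⅋ ℋ)))
      (↭-reflexive (++-assoc (map dual⅋ ℋ) _ _)))

-- Rules
-- acting on components ℋ use lift with the CP rule applied to the identity
-- expansions of ℋ; the rules & and ⊤, whose conclusion is a single
-- environment, act on ⅋Γ directly.
collapse : ∀ {P 𝒢} → ⊢H P ∶ 𝒢 → ⊢ₛ [ ⊗H 𝒢 ]
collapse (ax _) = s⅋ {[]} sax
collapse (cutR {𝒢 = 𝒢} {Γ} {Δ} {x} {A} _ d) =
  lift (Γ₁ ∷ Γ₂ ∷ []) Γ Δ 𝒢
    (sex (prep _ (shift _ (tys Γ) (tys Δ)))
      (scut {dual⅋ Γ₁ ∷ tys Γ} {dual⅋ Γ₂ ∷ tys Δ} (focus Γ [ (x , A) ]) (focus Δ [ (x , dual A) ])))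
    (collapse d)
  where
  Γ₁ Γ₂ : Env
  Γ₁ = Γ ++ [ (x , A) ]
  Γ₂ = Δ ++ [ (x , dual A) ]
collapse (mix {𝒢 = 𝒢} {ℋ} d e) = ⊗H-++ 𝒢 ℋ (collapse d) (collapse e)
collapse mix₀ = s𝟏
collapse (⊗R {𝒢 = 𝒢} {Γ} {Δ} {x} {y} {A} {B} _ _ d) =
  lift (Γ₁ ∷ Γ₂ ∷ []) Γ (Δ ++ [ (x , A ⊗ B) ]) 𝒢
    (subst (λ Ξ → ⊢ₛ (dual⅋ Γ₁ ∷ dual⅋ Γ₂ ∷ tys Γ ++ Ξ)) (sym (tys-++ Δ _))
      (sex (prep _ (shift _ (tys Γ) (tys Δ ++ [ A ⊗ B ])))
        (s⊗ {dual⅋ Γ₁ ∷ tys Γ} {dual⅋ Γ₂ ∷ tys Δ} (focus Γ [ (y , A) ]) (focus Δ [ (x , B) ]))))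
    (collapse d)
  where
  Γ₁ Γ₂ : Env
  Γ₁ = Γ ++ [ (y , A) ]
  Γ₂ = Δ ++ [ (x , B) ]
collapse (⅋R {𝒢 = 𝒢} {Γ} {x} {y} {A} {B} _ _ d) =
  lift [ _ ] Γ [ (x , A ⅋ B) ] 𝒢 (s⅋ {_ ∷ tys Γ} (focus Γ ((y , A) ∷ (x , B) ∷ []))) (collapse d)
collapse (𝟏R {𝒢 = 𝒢} {x} _ d) = lift [] [] [ (x , 𝟏) ] 𝒢 s𝟏 (collapse d)
collapse (⊥R {𝒢 = 𝒢} {Γ} {x} _ _ d) =
  lift [ Γ ] Γ [ (x , ⊥̂) ] 𝒢 (s⊥ {_ ∷ tys Γ} (env-expand Γ)) (collapse d)
collapse (⊕₁R {𝒢 = 𝒢} {Γ} {x} {A} _ _ d) =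
  lift [ _ ] Γ [ (x , _) ] 𝒢 (s⊕₁ {_ ∷ tys Γ} (focus Γ [ (x , A) ])) (collapse d)
collapse (⊕₂R {𝒢 = 𝒢} {Γ} {x} {B = B} _ _ d) =
  lift [ _ ] Γ [ (x , _) ] 𝒢 (s⊕₂ {_ ∷ tys Γ} (focus Γ [ (x , B) ])) (collapse d)
collapse (&R {Γ = Γ} {x} {A} {B} _ d e) =
  ⅋Env-intro [] Γ [ (x , A & B) ]
    (s& {tys Γ} (cut-components _ [ Γ ++ [ (x , A) ] ] (collapse d) (focus Γ [ (x , A) ]))
                (cut-components _ [ Γ ++ [ (x , B) ] ] (collapse e) (focus Γ [ (x , B) ])))
collapse (⊤R {Γ} {x} _) = ⅋Env-intro [] Γ [ (x , ⊤̂) ] (s⊤ {tys Γ})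
collapse (ex {𝒢 = 𝒢} {Γ} {Γ'} p d) =
  lift [ Γ ] [] Γ' 𝒢 (sex (prep _ (map⁺ proj₂ p)) (env-expand Γ)) (collapse d)
collapse (hex p d) = ⊗H-↭ p (collapse d)

theorem37 : (𝒢 : HEnv) → (P : HCP) → ⊢H P ∶ 𝒢 →
    Σ CP (λ Q → Σ Name (λ z → ⊢CP Q ∶ [ (z , ⊗H 𝒢) ]))
theorem37 𝒢 P d =
  let (Q , ⊢Q) = name (collapse d) [ (0 , ⊗H 𝒢) ] refl ([] ∷ [])
  in Q , 0 , ⊢Q
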